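{- Let $\Phi,\Psi$ be assertions over $\bigcup_{i=1}^{k+l}\mathcal{V}_i$, let $\mathbb{P}_1,\dots,\mathbb{P}_{k+l}$ be programs with $\mathbb{P}_i$ over $\mathcal{V}_i$, and let $(\Xi,\mathcal{C})$ be a parametric postcondition for $(\Phi,\mathbb{P}_1,\dots,\mathbb{P}_{k+l})$. If the closed formula $$\forall_{x\in\mathcal{V}_1\cup\cdots\cup\mathcal{V}_k}x.\ \exists_{\mu\in\mathfrak{P}}\mu.\ \Big(\mathcal{C}\wedge\forall_{x\in\mathcal{V}_{k+1}\cup\cdots\cup\mathcal{V}_{k+l}}x.\ (\Xi\Rightarrow\Psi)\Big)$$ holds, then the Forall-Exist Hoare Tuple $\langle\Phi\rangle\,\mathbb{P}_1\circledast\cdots\circledast\mathbb{P}_k\sim\mathbb{P}_{k+1}\circledast\cdots\circledast\mathbb{P}_{k+l}\,\langle\Psi\rangle$ is valid.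
   Context: Programs. Fix a set $\mathcal{V}$ of program variables. Programs are generated by $\mathbb{P},\mathbb{Q} ::= \mathtt{skip} \mid x := e \mid \mathtt{assume}(b) \mid \mathtt{if}(b,\mathbb{P},\mathbb{Q}) \mid \mathtt{while}(b,\mathbb{P}) \mid \mathbb{P};\mathbb{Q} \mid x := \star$, with $x\in\mathcal{V}$, $e$ a deterministic integer arithmetic expression and $b$ a deterministic Boolean expression. States are maps $\sigma:\mathcal{V}\to\mathbb{Z}$, and $[\![\mathbb{P}]\!](\sigma,\sigma')$ (standard big-step semantics) means $\mathbb{P}$, executed from $\sigma$, can terminate in $\sigma'$; here $x:=\star$ assigns an arbitrary integer to $x$, $\mathtt{assume}(b)$ continues only from states satisfying $b$, and the other constructs have their usual meaning. For $i\in\mathbb{N}$ let $\mathcal{V}_i=\{x_i:x\in\mathcal{V}\}$; a program over $\mathcal{V}_i$ uses only variables from $\mathcal{V}_i$. For states with disjoint domains, $\sigma_1\oplus\sigma_2$ is the combined state. Assertions are first-order formulas interpreted over states. FEHT validity. $\langle\Phi\rangle\,\mathbb{P}_1\circledast\cdots\circledast\mathbb{P}_k\sim\mathbb{P}_{k+1}\circledast\cdots\circledast\mathbb{P}_{k+l}\,\langle\Psi\rangle$ is valid if for all states $\sigma_1,\dots,\sigma_{k+l}$ (domains $\mathcal{V}_1,\dots,\mathcal{V}_{k+l}$) and $\sigma'_1,\dots,\sigma'_k$ with $\bigoplus_{i=1}^{k+l}\sigma_i\models\Phi$ and $[\![\mathbb{P}_i]\!](\sigma_i,\sigma'_i)$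 for $i\in[1,k]$, there exist $\sigma'_{k+1},\dots,\sigma'_{k+l}$ with $[\![\mathbb{P}_i]\!](\sigma_i,\sigma'_i)$ for $i\in[k+1,k+l]$ and $\bigoplus_{i=1}^{k+l}\sigma'_i\models\Psi$. Parametric assertions. Let $\mathfrak{P}=\{\mu_1,\dots,\mu_n\}$ be a set of parameters (fresh variables ranging over $\mathbb{Z}$). A parametric assertion is a pair $(\Xi,\mathcal{C})$ with $\Xi$ a formula over $\bigcup_{i=1}^{k+l}\mathcal{V}_i\cup\mathfrak{P}$ and $\mathcal{C}$ a formula over $\mathfrak{P}$. For a parameter evaluation $\kappa:\mathfrak{P}\to\mathbb{Z}$, $\Xi[\kappa]$ is the formula over $\bigcup_{i=1}^{k+l}\mathcal{V}_i$ obtained by fixing each parameter to its $\kappa$-value. $(\Xi,\mathcal{C})$ is a parametric postcondition for $(\Phi,\mathbb{P}_1,\dots,\mathbb{P}_{k+l})$ if for all states $\sigma_1,\dots,\sigma_{k+l},\sigma'_1,\dots,\sigma'_k$ with $\bigoplus_{i=1}^{k+l}\sigma_i\models\Phi$ and $[\![\mathbb{P}_i]\!](\sigma_i,\sigma'_i)$ for all $i\in[1,k]$, and every $\kappa$ with $\kappa\models\mathcal{C}$: (1) there exist states $\sigma'_{k+1},\dots,\sigma'_{k+l}$ with $\bigoplus_{i=1}^{k+l}\sigma'_i\models\Xi[\kappa]$, and (2) for all $\sigma'_{k+1},\dots,\sigma'_{k+l}$ with $\bigoplus_{i=1}^{k+l}\sigma'_i\models\Xi[\kappa]$ we have $[\![\mathbb{P}_i]\!](\sigma_i,\sigma'_i)$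 for all $i\in[k+1,k+l]$. -}

module Defs where

open import Data.Nat using (ℕ)
open import Data.Integer using (ℤ)
open import Data.Bool using (Bool; true; false)
open import Data.Fin using (Fin; splitAt)
open import Data.Sum using ([_,_]′)
open import Data.Product using (∃; _×_)
open import Relation.Binary.Definitions using (DecidableEquality)
open import Relation.Binary.PropositionalEquality using (_≡_)
open import Relation.Nullary using (yes; no)

-- A fixed set 𝒱 of program variables, with decidable equality (needed for
-- state update).  Every copy 𝒱ᵢ is a tagged copy of 𝒱; a state σᵢ over 𝒱ᵢ is
-- represented as a map 𝒱 → ℤ.
module Lang (𝒱 : Set) (_≟_ : DecidableEquality 𝒱) where

  State : Set
  State = 𝒱 → ℤ

  AExp : Set
  AExp = State → ℤ

  BExp : Set
  BExp = State → Bool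

  data Prog : Set where
    skip   : Prog
    _≔_    : 𝒱 → AExp → Prog
    assume : BExp → Prog
    if     : BExp → Prog → Prog → Prog
    while  : BExp → Prog → Prog
    _⨾_    : Prog → Prog → Prog
    _≔⋆    : 𝒱 → Prog

  update : State → 𝒱 → ℤ → State
  update σ x n y with y ≟ x
  ... | yes _ = n
  ... | no  _ = σ y

  data ⟦_⟧ : Prog → State → State → Set where
    skip    : ∀ {σ} → ⟦ skip ⟧ σ σ
    assign  : ∀ {σ x e} → ⟦ x ≔ e ⟧ σ (update σ x (e σ))
    havoc   : ∀ {σ x} (n : ℤ) → ⟦ x ≔⋆ ⟧ σ (update σ x n)
    assume  : ∀ {σ b} → b σ ≡ true → ⟦ assume b ⟧ σ σ
    if-t    : ∀ {σ σ' b P Q} → b σ ≡ true  → ⟦ P ⟧ σ σ' → ⟦ if b P Q ⟧ σ σ'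
    if-f    : ∀ {σ σ' b P Q} → b σ ≡ false → ⟦ Q ⟧ σ σ' → ⟦ if b P Q ⟧ σ σ'
    while-f : ∀ {σ b P} → b σ ≡ false → ⟦ while b P ⟧ σ σ
    while-t : ∀ {σ σ' σ'' b P} → b σ ≡ true → ⟦ P ⟧ σ σ' →
              ⟦ while b P ⟧ σ' σ'' → ⟦ while b P ⟧ σ σ''
    seq     : ∀ {σ σ' σ'' P Q} → ⟦ P ⟧ σ σ' → ⟦ Q ⟧ σ' σ'' → ⟦ P ⨾ Q ⟧ σ σ''

  -- combined state over 𝒱₁ ∪ … ∪ 𝒱_{k+l}: copy i ↦ state of copy i
  CState : ℕ → Set
  CState m = Fin m → State

  _⊕_ : ∀ {k l} → CState k → CState l → CState (k Data.Nat.+ l)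
  _⊕_ {k} σ τ i = [ σ , τ ]′ (splitAt k i)

  Assertion : ℕ → Set₁
  Assertion m = CState m → Set

  FEHT : ∀ k l → Assertion (k Data.Nat.+ l) → (Fin k → Prog) → (Fin l → Prog) →
         Assertion (k Data.Nat.+ l) → Set
  FEHT k l Φ P Q Ψ =
    ∀ (σ : CState k) (τ : CState l) (σ' : CState k) →
    Φ (σ ⊕ τ) → (∀ i → ⟦ P i ⟧ (σ i) (σ' i)) →
    ∃ λ (τ' : CState l) → (∀ j → ⟦ Q j ⟧ (τ j) (τ' j)) × Ψ (σ' ⊕ τ')

  -- parameters 𝔓 = {μ₁,…,μₙ}; parameter evaluations κ : 𝔓 → ℤ
  ParamEval : ℕ → Set
  ParamEval n = Fin n → ℤ

  -- Ξ : formula over ⋃ 𝒱ᵢ ∪ 𝔓 ; Ξ σ κ is "σ ⊨ Ξ[κ]"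
  PAssertion : ℕ → ℕ → Set₁
  PAssertion m n = CState m → ParamEval n → Set

  IsParamPost : ∀ k l n → Assertion (k Data.Nat.+ l) → (Fin k → Prog) → (Fin l → Prog) →
                PAssertion (k Data.Nat.+ l) n → (ParamEval n → Set) → Set
  IsParamPost k l n Φ P Q Ξ 𝒞 =
    ∀ (σ : CState k) (τ : CState l) (σ' : CState k) →
    Φ (σ ⊕ τ) → (∀ i → ⟦ P i ⟧ (σ i) (σ' i)) →
    ∀ (κ : ParamEval n) → 𝒞 κ →
      (∃ λ (τ' : CState l) → Ξ (σ' ⊕ τ') κ)
    × (∀ (τ' : CState l) → Ξ (σ' ⊕ τ') κ → ∀ j → ⟦ Q j ⟧ (τ j) (τ' j))

  ClosedFormula : ∀ k l n → PAssertion (k Data.Nat.+ l) n → (ParamEval n → Set) →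
                  Assertion (k Data.Nat.+ l) → Set
  ClosedFormula k l n Ξ 𝒞 Ψ =
    ∀ (σ' : CState k) → ∃ λ (κ : ParamEval n) →
      𝒞 κ × (∀ (τ' : CState l) → Ξ (σ' ⊕ τ') κ → Ψ (σ' ⊕ τ'))

module Submission where

open import Defs
open import Data.Nat using (ℕ)
open import Data.Fin using (Fin)
open import Relation.Binary.Definitions using (DecidableEquality)
open import Data.Product using (_,_)

theorem3 : (𝒱 : Set) (_≟_ : DecidableEquality 𝒱) (k l n : ℕ)
    (Φ Ψ : Lang.Assertion 𝒱 _≟_ (k Data.Nat.+ l))
    (P : Fin k → Lang.Prog 𝒱 _≟_) (Q : Fin l → Lang.Prog 𝒱 _≟_)
    (Ξ : Lang.PAssertion 𝒱 _≟_ (k Data.Nat.+ l) n) (𝒞 : Lang.ParamEval 𝒱 _≟_ n → Set) →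
    Lang.IsParamPost 𝒱 _≟_ k l n Φ P Q Ξ 𝒞 →
    Lang.ClosedFormula 𝒱 _≟_ k l n Ξ 𝒞 Ψ →
    Lang.FEHT 𝒱 _≟_ k l Φ P Q Ψ
theorem3 𝒱 _≟_ k l n Φ Ψ P Q Ξ 𝒞 isParamPost closed σ τ σ' φ runs =
  let (κ , 𝒞κ , Ξ⇒Ψ)       = closed σ'
      ((τ' , Ξτ') , Ξ⇒runs) = isParamPost σ τ σ' φ runs κ 𝒞κ
  in  τ' , Ξ⇒runs τ' Ξτ' , Ξ⇒Ψ τ' Ξτ'
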